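{- Let $|q|<1$, let $k\geq1$ be an integer, and let the sums be over all integer $k$-tuples $\vec m=(m_1,\dots,m_k)$ with $m_1\ge m_2\ge\dots\ge m_k\ge0$. Then \[ \sum_{\vec{m}}\frac{q^{m_1(m_1-m_2)+m_2(m_2-m_3)+\dots+m_{k-1}(m_{k-1}-m_k)+m_k^2}}{(q;q)_{m_1}(q;q)_{m_1-m_2}\cdots(q;q)_{m_{k-1}}(q;q)_{m_{k-1}-m_k}(q;q)_{m_k}^2}=\frac{1}{(q;q)_{\infty}^k}, \] and \[ \sum_{\vec{m}}\frac{q^{k\left[m_1(m_1-m_2)+m_2(m_2-m_3)+\dots+m_{k-1}(m_{k-1}-m_k)+m_k^2-m_1\right]+m_1+m_2+\dots+m_k}}{(q^k;q^k)_{m_k}\prod_{i=1}^{k-1}(q^k;q^k)_{m_i-m_{i+1}}\prod_{i=1}^{k}(q^i;q^k)_{m_i}}=\frac{1}{(q;q)_{\infty}}. \]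
   Context: Notation: $(x;q)_n=(1-x)(1-xq)\cdots(1-xq^{n-1})$, $(x;q)_\infty=\prod_{i\ge0}(1-xq^i)$. -}

module Defs where

open import Data.Nat using (ℕ; zero; suc; _+_; _*_; _∸_; _≤ᵇ_; _≡ᵇ_)
open import Data.Nat.Divisibility using (_∣?_)
open import Data.Integer as ℤ using (ℤ)
open import Data.Bool using (Bool; true; false; if_then_else_; _∧_)
open import Data.List as List using (List; []; _∷_; upTo; map; concatMap; foldr)
open import Data.Vec as Vec using (Vec; []; _∷_)
open import Relation.Nullary.Decidable using (⌊_⌋)

-- Formal power series in q with integer coefficients:
-- a series is its coefficient function, f n = [q^n] f.

PS : Set
PS = ℕ → ℤ

zeroS : PS
zeroS _ = ℤ.0ℤ

oneS : PS
oneS n = if n ≡ᵇ 0 then ℤ.1ℤ else ℤ.0ℤ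

qpow : ℕ → PS
qpow a n = if n ≡ᵇ a then ℤ.1ℤ else ℤ.0ℤ

_⊕_ : PS → PS → PS
(f ⊕ g) n = f n ℤ.+ g n

sumℤ : List ℤ → ℤ
sumℤ = foldr ℤ._+_ ℤ.0ℤ

_⊛_ : PS → PS → PS
(f ⊛ g) n = sumℤ (map (λ i → f i ℤ.* g (n ∸ i)) (upTo (suc n)))

_^S_ : PS → ℕ → PS
f ^S zero  = oneS
f ^S suc k = f ⊛ (f ^S k)

-- 1/(1 - q^j) = Σ_{t ≥ 0} q^{j t}   (used only for j ≥ 1)
geoInv : ℕ → PS
geoInv j n = if ⌊ j ∣? n ⌋ then ℤ.1ℤ else ℤ.0ℤ

-- 1/(q^a ; q^d)_m = Π_{t=0}^{m-1} 1/(1 - q^{a + d t})   (a ≥ 1 in all uses)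
invPoch : ℕ → ℕ → ℕ → PS
invPoch a d zero    = oneS
invPoch a d (suc m) = invPoch a d m ⊛ geoInv (a + d * m)

hd : ∀ {n} → Vec ℕ n → ℕ
hd []      = 0
hd (x ∷ _) = x

decreasing : ∀ {n} → Vec ℕ n → Bool
decreasing []           = true
decreasing (x ∷ [])     = true
decreasing (x ∷ y ∷ xs) = (y ≤ᵇ x) ∧ decreasing (y ∷ xs)

-- d_i = m_i - m_{i+1}, with the convention m_{k+1} = 0
diffs : ∀ {n} → Vec ℕ n → Vec ℕ n
diffs []           = []
diffs (x ∷ [])     = x ∷ []
diffs (x ∷ y ∷ xs) = (x ∸ y) ∷ diffs (y ∷ xs)

sumV : ∀ {n} → Vec ℕ n → ℕ
sumV = Vec.foldr _ _+_ 0

-- Σ_i m_i (m_i - m_{i+1})  =  m_1(m_1-m_2) + ... + m_{k-1}(m_{k-1}-m_k) + m_k^2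
quadExp : ∀ {n} → Vec ℕ n → ℕ
quadExp m = sumV (Vec.zipWith _*_ m (diffs m))

prodS : ∀ {n} → Vec PS n → PS
prodS = Vec.foldr _ _⊛_ oneS

allVecs : (k B : ℕ) → List (Vec ℕ k)
allVecs zero    B = [] ∷ []
allVecs (suc k) B = concatMap (λ x → map (x ∷_) (allVecs k B)) (upTo (suc B))

truncSum : (k B : ℕ) → (Vec ℕ k → PS) → PS
truncSum k B term =
  foldr _⊕_ zeroS (map (λ m → if decreasing m then term m else zeroS) (allVecs k B))

-- First identity: summand
--   q^{quadExp m} / Π_{i=1}^{k} (q;q)_{m_i} (q;q)_{m_i - m_{i+1}}
-- (with m_{k+1} = 0 this is exactly the denominator
--  (q;q)_{m_1}(q;q)_{m_1-m_2}...(q;q)_{m_{k-1}}(q;q)_{m_{k-1}-m_k}(q;q)_{m_k}^2)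
term1 : ∀ {k} → Vec ℕ k → PS
term1 m = qpow (quadExp m)
        ⊛ (prodS (Vec.map (invPoch 1 1) m) ⊛ prodS (Vec.map (invPoch 1 1) (diffs m)))

prodIdx : ℕ → ℕ → ∀ {n} → Vec ℕ n → PS
prodIdx k i []       = oneS
prodIdx k i (x ∷ xs) = invPoch i k x ⊛ prodIdx k (suc i) xs

-- Second identity: summand
--   q^{k[quadExp m - m_1] + m_1 + ... + m_k}
--   / ( (q^k;q^k)_{m_k} Π_{i<k} (q^k;q^k)_{m_i - m_{i+1}} Π_{i=1}^{k} (q^i;q^k)_{m_i} )
-- The exponent is a nonnegative integer for decreasing tuples; it is
-- computed as (k * quadExp m + Σ m_i) ∸ k * m_1, which is exact there.
term2 : ∀ {k} → Vec ℕ k → PS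
term2 {k} m = qpow ((k * quadExp m + sumV m) ∸ k * hd m)
            ⊛ (prodS (Vec.map (invPoch k k) (diffs m)) ⊛ prodIdx k 1 m)

-- Equality of two formal power series given as limits (in the q-adic topology)
-- of sequences of partial sums/products: every coefficient eventually agrees.
EqLim : (ℕ → PS) → (ℕ → PS) → Set
EqLim S T = ∀ N → Σ' N
  where
  open import Data.Product using (∃-syntax)
  open import Relation.Binary.PropositionalEquality using (_≡_)
  open import Data.Nat using (_≤_)
  Σ' : ℕ → Set
  Σ' N = ∃[ B₀ ] (∀ B → B₀ ≤ B → S B N ≡ T B N)

{-# OPTIONS --safe #-}
-- Everything is proved coefficientwise modulo q^(N+1).  The engine is a family of
-- Durfee-type identities: for K, c ≥ 1 and every n,
--   Σ_a q^(K a (a+n-1) + c a) / ((q^K;q^K)_a (q^c;q^K)_(a+n)) = 1/(q^c;q^K)_∞.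
-- Adding correction terms q^(…)/((q^K;q^K)_(a-1) (q^c;q^K)_(a+n)) makes the summands for
-- n and n+1 telescope, so the sum does not depend on n; for n > N only the a = 0 term
-- 1/(q^c;q^K)_n survives modulo q^(N+1).
-- Both sums over decreasing tuples are evaluated by summing over m_1 first: writing
-- m_1 = m_2 + a, the part of the summand that depends on m_1 is the a-th term of such an
-- identity with n = m_2 (K = c = 1 for the first sum, K = k and c = i at the i-th
-- coordinate of the second), so each coordinate contributes 1/(q;q)_∞, respectively
-- 1/(q^i;q^k)_∞, and Π_{i=1}^k (q^i;q^k)_M = (q;q)_(kM).
module Submission where

open import Defs
open import Data.Nat as ℕ
  using (ℕ; zero; suc; _+_; _*_; _∸_; _≤_; _<_; _≤ᵇ_; z≤n; s≤s; _≤′_; ≤′-reflexive; ≤′-step)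
import Data.Nat.Properties as ℕₚ
open import Data.Nat.Tactic.RingSolver using (solve-∀)
open import Data.Nat.Divisibility using (_∣?_; ∣m+n∣m⇒∣n; ∣m∣n⇒∣m+n; ∣⇒≤; ∣-refl)
open import Data.Integer using (ℤ; 0ℤ; 1ℤ) renaming (_+_ to _+ᶻ_; _*_ to _*ᶻ_)
import Data.Integer.Properties as ℤₚ
open import Data.Bool using (true; false; if_then_else_; _∧_; T)
open import Data.Bool.Properties using (T-≡)
open import Data.List using (List; []; _∷_; _++_; _∷ʳ_; applyUpTo; upTo; map; concatMap; foldr)
import Data.List.Properties as Listₚ
open import Data.Vec as Vec using (Vec; []; _∷_)
open import Data.Product using (_×_; _,_; proj₁; proj₂)
open import Data.Sum using (inj₁; inj₂)
open import Function using (_∘_)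
open import Function.Bundles using (mk⇔; module Equivalence)
open import Data.Empty using (⊥-elim)
open import Relation.Nullary using (Dec; yes; no)
open import Relation.Nullary.Decidable using (⌊_⌋; isYes≗does; does-⇔)
open import Relation.Binary.PropositionalEquality
open import Relation.Binary.Structures using (IsEquivalence)
open import Algebra.Bundles using (CommutativeSemiring)
import Relation.Binary.Reasoning.Setoid as SetoidReasoning
open import Algebra.Properties.CommutativeSemigroup ℤₚ.+-commutativeSemigroup
  using () renaming (interchange to +ᶻ-interchange)

sumUpTo : (ℕ → ℤ) → ℕ → ℤ
sumUpTo F n = sumℤ (applyUpTo F n)

sumUpTo-suc : ∀ F n → sumUpTo F (suc n) ≡ sumUpTo F n +ᶻ F n
sumUpTo-suc F zero    = trans (ℤₚ.+-identityʳ (F 0)) (sym (ℤₚ.+-identityˡ (F 0)))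
sumUpTo-suc F (suc n) =
  trans (cong (F 0 +ᶻ_) (sumUpTo-suc (F ∘ suc) n)) (sym (ℤₚ.+-assoc (F 0) _ _))

sumUpTo-cong : ∀ F G n → (∀ i → i < n → F i ≡ G i) → sumUpTo F n ≡ sumUpTo G n
sumUpTo-cong F G zero    F≡G = refl
sumUpTo-cong F G (suc n) F≡G =
  cong₂ _+ᶻ_ (F≡G 0 (s≤s z≤n))
             (sumUpTo-cong (F ∘ suc) (G ∘ suc) n (λ i i<n → F≡G (suc i) (s≤s i<n)))

sumUpTo-+ : ∀ F G n → sumUpTo (λ i → F i +ᶻ G i) n ≡ sumUpTo F n +ᶻ sumUpTo G n
sumUpTo-+ F G zero    = refl
sumUpTo-+ F G (suc n) =
  trans (cong (F 0 +ᶻ G 0 +ᶻ_) (sumUpTo-+ (F ∘ suc) (G ∘ suc) n))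
        (+ᶻ-interchange (F 0) (G 0) _ _)

sumUpTo-*ˡ : ∀ c F n → sumUpTo (λ i → c *ᶻ F i) n ≡ c *ᶻ sumUpTo F n
sumUpTo-*ˡ c F zero    = sym (ℤₚ.*-zeroʳ c)
sumUpTo-*ˡ c F (suc n) =
  trans (cong (c *ᶻ F 0 +ᶻ_) (sumUpTo-*ˡ c (F ∘ suc) n)) (sym (ℤₚ.*-distribˡ-+ c (F 0) _))

sumUpTo-zero : ∀ F n → (∀ i → i < n → F i ≡ 0ℤ) → sumUpTo F n ≡ 0ℤ
sumUpTo-zero F n F≡0 = trans (sumUpTo-cong F (λ _ → 0ℤ) n F≡0) (sumUpTo-const0 n)
  where
  sumUpTo-const0 : ∀ n → sumUpTo (λ _ → 0ℤ) n ≡ 0ℤ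
  sumUpTo-const0 zero    = refl
  sumUpTo-const0 (suc n) = cong (0ℤ +ᶻ_) (sumUpTo-const0 n)

infix 4 _≐_
_≐_ : PS → PS → Set
f ≐ g = ∀ n → f n ≡ g n

≐-isEquivalence : IsEquivalence _≐_
≐-isEquivalence = record
  { refl  = λ _ → refl
  ; sym   = λ f≐g n → sym (f≐g n)
  ; trans = λ f≐g g≐h n → trans (f≐g n) (g≐h n)
  }

open IsEquivalence ≐-isEquivalence public
  using () renaming (refl to ≐-refl; sym to ≐-sym; trans to ≐-trans)

≡⇒≐ : ∀ {f g} → f ≡ g → f ≐ g
≡⇒≐ refl _ = refl

tailS : PS → PS
tailS f n = f (suc n)

⊛-coeff : ∀ f g n → (f ⊛ g) n ≡ sumUpTo (λ i → f i *ᶻ g (n ∸ i)) (suc n)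
⊛-coeff f g n = cong sumℤ (Listₚ.map-upTo (λ i → f i *ᶻ g (n ∸ i)) (suc n))

⊛-suc : ∀ f g n → (f ⊛ g) (suc n) ≡ f 0 *ᶻ g (suc n) +ᶻ (tailS f ⊛ g) n
⊛-suc f g n =
  trans (⊛-coeff f g (suc n)) (cong (f 0 *ᶻ g (suc n) +ᶻ_) (sym (⊛-coeff (tailS f) g n)))

⊛-sucʳ : ∀ f g n → (f ⊛ g) (suc n) ≡ (f ⊛ tailS g) n +ᶻ f (suc n) *ᶻ g 0
⊛-sucʳ f g n = begin
  (f ⊛ g) (suc n)                                       ≡⟨ ⊛-coeff f g (suc n) ⟩
  sumUpTo F (suc (suc n))                               ≡⟨ sumUpTo-suc F (suc n) ⟩
  sumUpTo F (suc n) +ᶻ f (suc n) *ᶻ g (suc n ∸ suc n)   ≡⟨ cong₂ _+ᶻ_ shifted last ⟩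
  sumUpTo (λ i → f i *ᶻ tailS g (n ∸ i)) (suc n) +ᶻ f (suc n) *ᶻ g 0
    ≡⟨ cong (_+ᶻ f (suc n) *ᶻ g 0) (sym (⊛-coeff f (tailS g) n)) ⟩
  (f ⊛ tailS g) n +ᶻ f (suc n) *ᶻ g 0                   ∎
  where
  open ≡-Reasoning
  F : ℕ → ℤ
  F i = f i *ᶻ g (suc n ∸ i)
  shifted : sumUpTo F (suc n) ≡ sumUpTo (λ i → f i *ᶻ tailS g (n ∸ i)) (suc n)
  shifted = sumUpTo-cong F (λ i → f i *ᶻ tailS g (n ∸ i)) (suc n)
              (λ i i<1+n → cong (λ t → f i *ᶻ g t) (ℕₚ.+-∸-assoc 1 (ℕₚ.≤-pred i<1+n)))
  last : f (suc n) *ᶻ g (suc n ∸ suc n) ≡ f (suc n) *ᶻ g 0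
  last = cong (λ t → f (suc n) *ᶻ g t) (ℕₚ.n∸n≡0 n)

⊛-cong : ∀ {f f′ g g′} → f ≐ f′ → g ≐ g′ → f ⊛ g ≐ f′ ⊛ g′
⊛-cong {f} {f′} {g} {g′} f≐f′ g≐g′ n =
  trans (⊛-coeff f g n)
        (trans (sumUpTo-cong (λ i → f i *ᶻ g (n ∸ i)) (λ i → f′ i *ᶻ g′ (n ∸ i)) (suc n)
                             (λ i _ → cong₂ _*ᶻ_ (f≐f′ i) (g≐g′ (n ∸ i))))
               (sym (⊛-coeff f′ g′ n)))

⊕-cong : ∀ {f f′ g g′} → f ≐ f′ → g ≐ g′ → f ⊕ g ≐ f′ ⊕ g′
⊕-cong f≐f′ g≐g′ n = cong₂ _+ᶻ_ (f≐f′ n) (g≐g′ n)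

⊛-comm : ∀ f g → f ⊛ g ≐ g ⊛ f
⊛-comm f g zero    = cong (_+ᶻ 0ℤ) (ℤₚ.*-comm (f 0) (g 0))
⊛-comm f g (suc n) = begin
  (f ⊛ g) (suc n)                          ≡⟨ ⊛-suc f g n ⟩
  f 0 *ᶻ g (suc n) +ᶻ (tailS f ⊛ g) n      ≡⟨ ℤₚ.+-comm (f 0 *ᶻ g (suc n)) _ ⟩
  (tailS f ⊛ g) n +ᶻ f 0 *ᶻ g (suc n)
    ≡⟨ cong₂ _+ᶻ_ (⊛-comm (tailS f) g n) (ℤₚ.*-comm (f 0) (g (suc n))) ⟩
  (g ⊛ tailS f) n +ᶻ g (suc n) *ᶻ f 0      ≡⟨ sym (⊛-sucʳ g f n) ⟩
  (g ⊛ f) (suc n)                          ∎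
  where open ≡-Reasoning

_•_ : ℤ → PS → PS
(c • f) n = c *ᶻ f n

⊛-distribʳ : ∀ f g h → (f ⊕ g) ⊛ h ≐ (f ⊛ h) ⊕ (g ⊛ h)
⊛-distribʳ f g h n =
  trans (⊛-coeff (f ⊕ g) h n)
  (trans (sumUpTo-cong (λ i → (f ⊕ g) i *ᶻ h (n ∸ i))
                       (λ i → f i *ᶻ h (n ∸ i) +ᶻ g i *ᶻ h (n ∸ i)) (suc n)
                       (λ i _ → ℤₚ.*-distribʳ-+ (h (n ∸ i)) (f i) (g i)))
  (trans (sumUpTo-+ (λ i → f i *ᶻ h (n ∸ i)) (λ i → g i *ᶻ h (n ∸ i)) (suc n))
         (sym (cong₂ _+ᶻ_ (⊛-coeff f h n) (⊛-coeff g h n)))))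

•-⊛ : ∀ c f g → (c • f) ⊛ g ≐ c • (f ⊛ g)
•-⊛ c f g n =
  trans (⊛-coeff (c • f) g n)
  (trans (sumUpTo-cong (λ i → (c • f) i *ᶻ g (n ∸ i)) (λ i → c *ᶻ (f i *ᶻ g (n ∸ i))) (suc n)
                       (λ i _ → ℤₚ.*-assoc c (f i) (g (n ∸ i))))
  (trans (sumUpTo-*ˡ c (λ i → f i *ᶻ g (n ∸ i)) (suc n))
         (cong (c *ᶻ_) (sym (⊛-coeff f g n)))))

⊛-zeroˡ : ∀ f → zeroS ⊛ f ≐ zeroS
⊛-zeroˡ f n =
  trans (⊛-coeff zeroS f n)
        (sumUpTo-zero (λ i → zeroS i *ᶻ f (n ∸ i)) (suc n) (λ i _ → ℤₚ.*-zeroˡ (f (n ∸ i))))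

⊛-identityˡ : ∀ f → oneS ⊛ f ≐ f
⊛-identityˡ f zero    = trans (ℤₚ.+-identityʳ _) (ℤₚ.*-identityˡ (f 0))
⊛-identityˡ f (suc n) =
  trans (⊛-suc oneS f n)
        (trans (cong₂ _+ᶻ_ (ℤₚ.*-identityˡ (f (suc n))) (⊛-zeroˡ f n)) (ℤₚ.+-identityʳ _))

⊛-assoc : ∀ f g h → (f ⊛ g) ⊛ h ≐ f ⊛ (g ⊛ h)
⊛-assoc f g h zero = begin
  ((f 0 *ᶻ g 0 +ᶻ 0ℤ) *ᶻ h 0 +ᶻ 0ℤ)   ≡⟨ ℤₚ.+-identityʳ ((f 0 *ᶻ g 0 +ᶻ 0ℤ) *ᶻ h 0) ⟩
  (f 0 *ᶻ g 0 +ᶻ 0ℤ) *ᶻ h 0           ≡⟨ cong (_*ᶻ h 0) (ℤₚ.+-identityʳ (f 0 *ᶻ g 0)) ⟩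
  f 0 *ᶻ g 0 *ᶻ h 0                   ≡⟨ ℤₚ.*-assoc (f 0) (g 0) (h 0) ⟩
  f 0 *ᶻ (g 0 *ᶻ h 0)                 ≡⟨ cong (f 0 *ᶻ_) (sym (ℤₚ.+-identityʳ (g 0 *ᶻ h 0))) ⟩
  f 0 *ᶻ (g 0 *ᶻ h 0 +ᶻ 0ℤ)           ≡⟨ sym (ℤₚ.+-identityʳ (f 0 *ᶻ (g 0 *ᶻ h 0 +ᶻ 0ℤ))) ⟩
  (f 0 *ᶻ (g 0 *ᶻ h 0 +ᶻ 0ℤ) +ᶻ 0ℤ)   ∎
  where open ≡-Reasoning
⊛-assoc f g h (suc n) = begin
    ((f ⊛ g) ⊛ h) (suc n)
  ≡⟨ ⊛-suc (f ⊛ g) h n ⟩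
    (f ⊛ g) 0 *ᶻ h (suc n) +ᶻ (tailS (f ⊛ g) ⊛ h) n
  ≡⟨ cong₂ _+ᶻ_ (cong (_*ᶻ h (suc n)) (ℤₚ.+-identityʳ (f 0 *ᶻ g 0)))
                (⊛-cong {g = h} (⊛-suc f g) ≐-refl n) ⟩
    f 0 *ᶻ g 0 *ᶻ h (suc n) +ᶻ (((f 0 • tailS g) ⊕ (tailS f ⊛ g)) ⊛ h) n
  ≡⟨ cong (f 0 *ᶻ g 0 *ᶻ h (suc n) +ᶻ_)
          (trans (⊛-distribʳ (f 0 • tailS g) (tailS f ⊛ g) h n)
                 (cong₂ _+ᶻ_ (•-⊛ (f 0) (tailS g) h n) (⊛-assoc (tailS f) g h n))) ⟩
    f 0 *ᶻ g 0 *ᶻ h (suc n) +ᶻ (f 0 *ᶻ (tailS g ⊛ h) n +ᶻ (tailS f ⊛ (g ⊛ h)) n)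
  ≡⟨ sym (ℤₚ.+-assoc (f 0 *ᶻ g 0 *ᶻ h (suc n)) _ _) ⟩
    f 0 *ᶻ g 0 *ᶻ h (suc n) +ᶻ f 0 *ᶻ (tailS g ⊛ h) n +ᶻ (tailS f ⊛ (g ⊛ h)) n
  ≡⟨ cong (_+ᶻ (tailS f ⊛ (g ⊛ h)) n)
          (trans (cong (_+ᶻ f 0 *ᶻ (tailS g ⊛ h) n) (ℤₚ.*-assoc (f 0) (g 0) _))
                 (sym (ℤₚ.*-distribˡ-+ (f 0) (g 0 *ᶻ h (suc n)) _))) ⟩
    f 0 *ᶻ (g 0 *ᶻ h (suc n) +ᶻ (tailS g ⊛ h) n) +ᶻ (tailS f ⊛ (g ⊛ h)) n
  ≡⟨ cong (λ t → f 0 *ᶻ t +ᶻ (tailS f ⊛ (g ⊛ h)) n) (sym (⊛-suc g h n)) ⟩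
    f 0 *ᶻ (g ⊛ h) (suc n) +ᶻ (tailS f ⊛ (g ⊛ h)) n
  ≡⟨ sym (⊛-suc f (g ⊛ h) n) ⟩
    (f ⊛ (g ⊛ h)) (suc n)
  ∎
  where open ≡-Reasoning

PS-commutativeSemiring : CommutativeSemiring _ _
PS-commutativeSemiring = record
  { Carrier = PS ; _≈_ = _≐_ ; _+_ = _⊕_ ; _*_ = _⊛_ ; 0# = zeroS ; 1# = oneS
  ; isCommutativeSemiring = record
    { isSemiring = record
      { isSemiringWithoutAnnihilatingZero = record
        { +-isCommutativeMonoid = record
          { isMonoid = record
            { isSemigroup = record
              { isMagma = record { isEquivalence = ≐-isEquivalence ; ∙-cong = ⊕-cong }
              ; assoc = λ f g h n → ℤₚ.+-assoc (f n) (g n) (h n) }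
            ; identity = (λ f n → ℤₚ.+-identityˡ (f n)) , (λ f n → ℤₚ.+-identityʳ (f n)) }
          ; comm = λ f g n → ℤₚ.+-comm (f n) (g n) }
        ; *-cong = ⊛-cong
        ; *-assoc = ⊛-assoc
        ; *-identity = ⊛-identityˡ , λ f → ≐-trans (⊛-comm f oneS) (⊛-identityˡ f)
        ; distrib = (λ f g h → ≐-trans (⊛-comm f (g ⊕ h))
                       (≐-trans (⊛-distribʳ g h f) (⊕-cong (⊛-comm g f) (⊛-comm h f))))
                  , (λ h f g → ⊛-distribʳ f g h) }
      ; zero = ⊛-zeroˡ , λ f → ≐-trans (⊛-comm f zeroS) (⊛-zeroˡ f) }
    ; *-comm = ⊛-comm } }

open CommutativeSemiring PS-commutativeSemiring public
  using () renaming (*-identityʳ to ⊛-identityʳ; zeroʳ to ⊛-zeroʳ; distribˡ to ⊛-distribˡ;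
                     +-identityˡ to ⊕-identityˡ; +-identityʳ to ⊕-identityʳ; +-assoc to ⊕-assoc;
                     +-commutativeSemigroup to PS-+-commutativeSemigroup; setoid to PS-setoid)
open import Algebra.Solver.Ring.NaturalCoefficients.Default PS-commutativeSemiring public
module ≐-Reasoning = SetoidReasoning PS-setoid
open import Algebra.Properties.CommutativeSemigroup PS-+-commutativeSemigroup public
  using () renaming (interchange to ⊕-interchange)

shiftS : ℕ → PS → PS
shiftS zero    f         = f
shiftS (suc a) f zero    = 0ℤ
shiftS (suc a) f (suc n) = shiftS a f n

shiftS-+ : ∀ a f n → shiftS a f (a + n) ≡ f n
shiftS-+ zero    f n = refl
shiftS-+ (suc a) f n = shiftS-+ a f n

shiftS-< : ∀ a f {n} → n < a → shiftS a f n ≡ 0ℤ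
shiftS-< (suc a) f {zero}  _         = refl
shiftS-< (suc a) f {suc n} (s≤s n<a) = shiftS-< a f n<a

qpow-⊛ : ∀ a f → qpow a ⊛ f ≐ shiftS a f
qpow-⊛ zero    f         = ⊛-identityˡ f
qpow-⊛ (suc a) f zero    = trans (ℤₚ.+-identityʳ (0ℤ *ᶻ f 0)) (ℤₚ.*-zeroˡ (f 0))
qpow-⊛ (suc a) f (suc n) = begin
  (qpow (suc a) ⊛ f) (suc n)               ≡⟨ ⊛-suc (qpow (suc a)) f n ⟩
  0ℤ *ᶻ f (suc n) +ᶻ (qpow a ⊛ f) n        ≡⟨ cong (_+ᶻ (qpow a ⊛ f) n) (ℤₚ.*-zeroˡ (f (suc n))) ⟩
  0ℤ +ᶻ (qpow a ⊛ f) n                     ≡⟨ ℤₚ.+-identityˡ ((qpow a ⊛ f) n) ⟩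
  (qpow a ⊛ f) n                           ≡⟨ qpow-⊛ a f n ⟩
  shiftS (suc a) f (suc n)                 ∎
  where open ≡-Reasoning

shiftS-qpow : ∀ a b → shiftS a (qpow b) ≐ qpow (a + b)
shiftS-qpow zero    b n       = refl
shiftS-qpow (suc a) b zero    = refl
shiftS-qpow (suc a) b (suc n) = shiftS-qpow a b n

qpow-⊛-qpow : ∀ a b → qpow a ⊛ qpow b ≐ qpow (a + b)
qpow-⊛-qpow a b = ≐-trans (qpow-⊛ a (qpow b)) (shiftS-qpow a b)

infix 4 _≈[_]_
_≈[_]_ : PS → ℕ → PS → Set
f ≈[ N ] g = ∀ n → n ≤ N → f n ≡ g n

≐⇒≈ : ∀ {f g N} → f ≐ g → f ≈[ N ] g
≐⇒≈ f≐g n _ = f≐g n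

≈-refl : ∀ {f N} → f ≈[ N ] f
≈-refl n _ = refl

≈-sym : ∀ {f g N} → f ≈[ N ] g → g ≈[ N ] f
≈-sym f≈g n n≤N = sym (f≈g n n≤N)

≈-trans : ∀ {f g h N} → f ≈[ N ] g → g ≈[ N ] h → f ≈[ N ] h
≈-trans f≈g g≈h n n≤N = trans (f≈g n n≤N) (g≈h n n≤N)

⊕-cong≈ : ∀ {f f′ g g′ N} → f ≈[ N ] f′ → g ≈[ N ] g′ → f ⊕ g ≈[ N ] f′ ⊕ g′
⊕-cong≈ f≈f′ g≈g′ n n≤N = cong₂ _+ᶻ_ (f≈f′ n n≤N) (g≈g′ n n≤N)

⊛-cong≈ : ∀ {f f′ g g′ N} → f ≈[ N ] f′ → g ≈[ N ] g′ → f ⊛ g ≈[ N ] f′ ⊛ g′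
⊛-cong≈ {f} {f′} {g} {g′} f≈f′ g≈g′ n n≤N =
  trans (⊛-coeff f g n)
  (trans (sumUpTo-cong (λ i → f i *ᶻ g (n ∸ i)) (λ i → f′ i *ᶻ g′ (n ∸ i)) (suc n) termwise)
         (sym (⊛-coeff f′ g′ n)))
  where
  termwise : ∀ i → i < suc n → f i *ᶻ g (n ∸ i) ≡ f′ i *ᶻ g′ (n ∸ i)
  termwise i i<1+n = cong₂ _*ᶻ_ (f≈f′ i (ℕₚ.≤-trans (ℕₚ.≤-pred i<1+n) n≤N))
                                (g≈g′ (n ∸ i) (ℕₚ.≤-trans (ℕₚ.m∸n≤m n i) n≤N))

^S-cong≈ : ∀ {f g N} k → f ≈[ N ] g → f ^S k ≈[ N ] g ^S k
^S-cong≈ zero    f≈g = ≈-refl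
^S-cong≈ (suc k) f≈g = ⊛-cong≈ f≈g (^S-cong≈ k f≈g)

qpow-⊛≈zero : ∀ {N} a f → N < a → qpow a ⊛ f ≈[ N ] zeroS
qpow-⊛≈zero a f N<a n n≤N = trans (qpow-⊛ a f n) (shiftS-< a f (ℕₚ.≤-<-trans n≤N N<a))

⊛-cong≈zero : ∀ {N} f {g} → g ≈[ N ] zeroS → f ⊛ g ≈[ N ] zeroS
⊛-cong≈zero f g≈0 = ≈-trans (⊛-cong≈ (≈-refl {f}) g≈0) (≐⇒≈ (⊛-zeroʳ f))

⌊⌋-⇔ : ∀ {P Q : Set} → (P → Q) → (Q → P) → (p : Dec P) (q : Dec Q) → ⌊ p ⌋ ≡ ⌊ q ⌋
⌊⌋-⇔ P→Q Q→P p q =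
  trans (isYes≗does p) (trans (does-⇔ (mk⇔ P→Q Q→P) p q) (sym (isYes≗does q)))

geoInv-suc : ∀ j m → geoInv (suc j) (suc m) ≡ shiftS j (geoInv (suc j)) m
geoInv-suc j m with ℕₚ.≤-<-connex j m
... | inj₁ j≤m = begin
  geoInv (suc j) (suc m)                 ≡⟨ cong (geoInv (suc j) ∘ suc) (sym m≡j+r) ⟩
  geoInv (suc j) (suc (j + r))           ≡⟨ cong (λ b → if b then 1ℤ else 0ℤ) divides-shift ⟩
  geoInv (suc j) r                       ≡⟨ sym (shiftS-+ j (geoInv (suc j)) r) ⟩
  shiftS j (geoInv (suc j)) (j + r)      ≡⟨ cong (shiftS j (geoInv (suc j))) m≡j+r ⟩
  shiftS j (geoInv (suc j)) m            ∎
  where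
  open ≡-Reasoning
  r = m ∸ j
  m≡j+r : j + r ≡ m
  m≡j+r = ℕₚ.m+[n∸m]≡n j≤m
  divides-shift : ⌊ suc j ∣? suc (j + r) ⌋ ≡ ⌊ suc j ∣? r ⌋
  divides-shift = ⌊⌋-⇔ (λ d → ∣m+n∣m⇒∣n d ∣-refl) (∣m∣n⇒∣m+n ∣-refl)
                       (suc j ∣? suc (j + r)) (suc j ∣? r)
... | inj₂ m<j =
  trans (cong (λ b → if b then 1ℤ else 0ℤ)
              (⌊⌋-⇔ (λ d → ℕₚ.<⇒≱ (s≤s m<j) (∣⇒≤ d)) (λ ()) (suc j ∣? suc m) (no (λ ()))))
        (sym (shiftS-< j (geoInv (suc j)) m<j))

geoInv-unfold : ∀ j → geoInv (suc j) ≐ oneS ⊕ (qpow (suc j) ⊛ geoInv (suc j))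
geoInv-unfold j zero    = sym (cong (1ℤ +ᶻ_) (qpow-⊛ (suc j) (geoInv (suc j)) 0))
geoInv-unfold j (suc m) =
  trans (geoInv-suc j m)
        (sym (trans (ℤₚ.+-identityˡ _) (qpow-⊛ (suc j) (geoInv (suc j)) (suc m))))

geoInv≈one : ∀ {N} j → N < j → geoInv j ≈[ N ] oneS
geoInv≈one (suc j) N<j =
  ≈-trans (≐⇒≈ (geoInv-unfold j))
  (≈-trans (⊕-cong≈ (≈-refl {oneS}) (qpow-⊛≈zero (suc j) (geoInv (suc j)) N<j))
           (≐⇒≈ (⊕-identityʳ oneS)))

invPoch-unfold : ∀ c d m → invPoch (suc c) d (suc m)
                         ≐ invPoch (suc c) d m ⊕ (qpow (suc c + d * m) ⊛ invPoch (suc c) d (suc m))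
invPoch-unfold c d m =
  ≐-trans (⊛-cong (≐-refl {invPoch (suc c) d m}) (geoInv-unfold (c + d * m)))
          (expand (invPoch (suc c) d m) (qpow (suc c + d * m)) (geoInv (suc c + d * m)))
  where
  expand : ∀ x z g → x ⊛ (oneS ⊕ (z ⊛ g)) ≐ x ⊕ (z ⊛ (x ⊛ g))
  expand = solve 3 (λ x z g → x :* (con 1 :+ z :* g) := x :+ z :* (x :* g)) ≐-refl

invPoch-stable : ∀ {N} c d m → N ≤ m → invPoch (suc c) (suc d) m ≈[ N ] invPoch (suc c) (suc d) N
invPoch-stable {N} c d m N≤m = stable (ℕₚ.≤⇒≤′ N≤m)
  where
  stable : ∀ {m} → N ≤′ m → invPoch (suc c) (suc d) m ≈[ N ] invPoch (suc c) (suc d) N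
  stable (≤′-reflexive refl) = ≈-refl
  stable (≤′-step {m} N≤′m) =
    ≈-trans (⊛-cong≈ (≈-refl {invPoch (suc c) (suc d) m}) (geoInv≈one (suc c + suc d * m) N<factor))
    (≈-trans (≐⇒≈ (⊛-identityʳ (invPoch (suc c) (suc d) m))) (stable N≤′m))
    where
    N<factor : N < suc c + suc d * m
    N<factor = s≤s (ℕₚ.≤-trans (ℕₚ.≤′⇒≤ N≤′m)
                    (ℕₚ.≤-trans (ℕₚ.m≤m+n m (d * m)) (ℕₚ.m≤n+m (suc d * m) c)))

invPoch-first : ∀ a d l → invPoch a d (suc l) ≐ geoInv a ⊛ invPoch (a + d) d l
invPoch-first a d zero =
  ≐-trans (⊛-identityˡ (geoInv (a + d * 0)))
  (≐-trans (≡⇒≐ (cong geoInv (trans (cong (a +_) (ℕₚ.*-zeroʳ d)) (ℕₚ.+-identityʳ a))))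
           (≐-sym (⊛-identityʳ (geoInv a))))
invPoch-first a d (suc l) =
  ≐-trans (⊛-cong (invPoch-first a d l) (≡⇒≐ (cong geoInv (exponent a d l))))
          (⊛-assoc (geoInv a) (invPoch (a + d) d l) (geoInv (a + d + d * l)))
  where
  exponent : ∀ a d l → a + d * suc l ≡ a + d + d * l
  exponent = solve-∀

invPoch-split : ∀ a d m r → invPoch a d (m + r) ≐ invPoch a d m ⊛ invPoch (a + d * m) d r
invPoch-split a d m zero =
  ≐-trans (≡⇒≐ (cong (invPoch a d) (ℕₚ.+-identityʳ m))) (≐-sym (⊛-identityʳ (invPoch a d m)))
invPoch-split a d m (suc r) =
  ≐-trans (≡⇒≐ (cong (invPoch a d) (ℕₚ.+-suc m r)))
  (≐-trans (⊛-cong (invPoch-split a d m r) (≡⇒≐ (cong geoInv (exponent a d m r))))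
           (⊛-assoc (invPoch a d m) (invPoch (a + d * m) d r) (geoInv (a + d * m + d * r))))
  where
  exponent : ∀ a d m r → a + d * (m + r) ≡ a + d * m + d * r
  exponent = solve-∀

sumS : (ℕ → PS) → ℕ → PS
sumS F zero    = zeroS
sumS F (suc A) = sumS F A ⊕ F A

sumS-cong : ∀ {F G} A → (∀ a → F a ≐ G a) → sumS F A ≐ sumS G A
sumS-cong zero    F≐G = ≐-refl
sumS-cong (suc A) F≐G = ⊕-cong (sumS-cong A F≐G) (F≐G A)

sumS-⊛ : ∀ F g A → sumS (λ a → F a ⊛ g) A ≐ sumS F A ⊛ g
sumS-⊛ F g zero    = ≐-sym (⊛-zeroˡ g)
sumS-⊛ F g (suc A) = ≐-trans (⊕-cong (sumS-⊛ F g A) ≐-refl) (≐-sym (⊛-distribʳ (sumS F A) (F A) g))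

sumS≈zero : ∀ {N} F A → (∀ a → a < A → F a ≈[ N ] zeroS) → sumS F A ≈[ N ] zeroS
sumS≈zero F zero    F≈0 = ≈-refl
sumS≈zero F (suc A) F≈0 =
  ≈-trans (⊕-cong≈ (sumS≈zero F A (λ a a<A → F≈0 a (ℕₚ.m≤n⇒m≤1+n a<A))) (F≈0 A ℕₚ.≤-refl))
          (≐⇒≈ (⊕-identityˡ zeroS))

sumS-from : ∀ y (G : ℕ → PS) r →
  sumS (λ x → if y ≤ᵇ x then G x else zeroS) (r + y) ≐ sumS (λ a → G (a + y)) r
sumS-from y G = go
  where
  H : ℕ → PS
  H x = if y ≤ᵇ x then G x else zeroS
  below : ∀ x → x ≤ y → sumS H x ≐ zeroS
  below zero    _   = ≐-refl
  below (suc x) x<y with y ≤ᵇ x in y≤ᵇx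
  ... | false = ≐-trans (⊕-cong (below x (ℕₚ.<⇒≤ x<y)) ≐-refl) (⊕-identityˡ zeroS)
  ... | true  = ⊥-elim (ℕₚ.<⇒≱ x<y (ℕₚ.≤ᵇ⇒≤ y x (Equivalence.from T-≡ y≤ᵇx)))
  above : ∀ r → H (r + y) ≐ G (r + y)
  above r = ≡⇒≐ (cong (λ b → if b then G (r + y) else zeroS)
                     (Equivalence.to T-≡ (ℕₚ.≤⇒≤ᵇ (ℕₚ.m≤n+m y r))))
  go : ∀ r → sumS H (r + y) ≐ sumS (λ a → G (a + y)) r
  go zero    = below y ℕₚ.≤-refl
  go (suc r) = ⊕-cong (go r) (above r)

durfeeExp : (K c n a : ℕ) → ℕ
durfeeExp K c n zero    = 0
durfeeExp K c n (suc a) = K * (suc a * (a + n)) + c * suc a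

durfeeExp-one : ∀ K c n → durfeeExp K c n 1 ≡ c + K * n
durfeeExp-one = unfolded
  where
  unfolded : ∀ K c n → K * (1 * (0 + n)) + c * 1 ≡ c + K * n
  unfolded = solve-∀

durfeeExp-suc-index : ∀ K c n a → durfeeExp K c (suc n) (suc a) ≡ durfeeExp K c n (suc a) + (K + K * a)
durfeeExp-suc-index = unfolded
  where
  unfolded : ∀ K c n a → K * (suc a * (a + suc n)) + c * suc a
                       ≡ K * (suc a * (a + n)) + c * suc a + (K + K * a)
  unfolded = solve-∀

durfeeExp-suc : ∀ K c n a → durfeeExp K c n (suc (suc a))
                          ≡ durfeeExp K c n (suc a) + (K + K * a) + (c + K * (suc a + n))
durfeeExp-suc = unfolded
  where
  unfolded : ∀ K c n a → K * (suc (suc a) * (suc a + n)) + c * suc (suc a)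
                       ≡ K * (suc a * (a + n)) + c * suc a + (K + K * a) + (c + K * (suc a + n))
  unfolded = solve-∀

size≤durfeeExp : ∀ K c n a → suc a ≤ durfeeExp K (suc c) n (suc a)
size≤durfeeExp K c n a =
  ℕₚ.≤-trans (ℕₚ.m≤m+n (suc a) (c * suc a)) (ℕₚ.m≤n+m (suc c * suc a) (K * (suc a * (a + n))))

index≤durfeeExp : ∀ K c n a → n ≤ durfeeExp (suc K) c n (suc a)
index≤durfeeExp K c n a = begin
  n                                    ≤⟨ ℕₚ.m≤n+m n a ⟩
  a + n                                ≤⟨ ℕₚ.m≤m+n (a + n) (a * (a + n)) ⟩
  suc a * (a + n)                      ≤⟨ ℕₚ.m≤m+n (suc a * (a + n)) (K * (suc a * (a + n))) ⟩
  suc K * (suc a * (a + n))            ≤⟨ ℕₚ.m≤m+n (suc K * (suc a * (a + n))) (c * suc a) ⟩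
  durfeeExp (suc K) c n (suc a)        ∎
  where open ℕₚ.≤-Reasoning

module Durfee (K′ c′ : ℕ) where

  K c : ℕ
  K = suc K′
  c = suc c′

  term : ℕ → ℕ → PS
  term n a = qpow (durfeeExp K c n a) ⊛ (invPoch K K a ⊛ invPoch c K (a + n))

  -- From 1/(q^K;q^K)_a = 1/(q^K;q^K)_(a-1) + q^(Ka)/(q^K;q^K)_a: the correction terms
  -- absorb the difference between the summands for n and n+1.
  correction : ℕ → ℕ → PS
  correction n zero    = zeroS
  correction n (suc a) = qpow (durfeeExp K c n (suc a)) ⊛ (invPoch K K a ⊛ invPoch c K (suc a + n))

  term-telescopes : ∀ n a → term n a ⊕ correction n (suc a) ≐ correction n a ⊕ term (suc n) a
  term-telescopes n zero = begin
    term n 0 ⊕ correction n 1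
      ≈⟨ ⊕-cong (≐-refl {term n 0}) (⊛-cong (≡⇒≐ (cong qpow (durfeeExp-one K c n))) ≐-refl) ⟩
    (oneS ⊛ (oneS ⊛ I n)) ⊕ (qpow (c + K * n) ⊛ (oneS ⊛ I (suc n)))
      ≈⟨ drop-units (I n) (I (suc n)) (qpow (c + K * n)) ⟩
    I n ⊕ (qpow (c + K * n) ⊛ I (suc n))
      ≈⟨ ≐-sym (invPoch-unfold c′ K n) ⟩
    I (suc n)
      ≈⟨ add-units (I (suc n)) ⟩
    correction n 0 ⊕ term (suc n) 0
      ∎
    where
    open ≐-Reasoning
    I : ℕ → PS
    I = invPoch c K
    drop-units : ∀ x y z → (oneS ⊛ (oneS ⊛ x)) ⊕ (z ⊛ (oneS ⊛ y)) ≐ x ⊕ (z ⊛ y)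
    drop-units = solve 3 (λ x y z → con 1 :* (con 1 :* x) :+ z :* (con 1 :* y) := x :+ z :* y) ≐-refl
    add-units : ∀ y → y ≐ zeroS ⊕ (oneS ⊛ (oneS ⊛ y))
    add-units = solve 1 (λ y → y := con 0 :+ con 1 :* (con 1 :* y)) ≐-refl
  term-telescopes n (suc a) = begin
    term n (suc a) ⊕ correction n (suc (suc a))
      ≈⟨ ⊕-cong (⊛-cong (≐-refl {E}) (⊛-cong (invPoch-unfold K′ K a) ≐-refl))
                (⊛-cong (≐-trans (≡⇒≐ (cong qpow (durfeeExp-suc K c n a))) (≐-sym split-E)) ≐-refl) ⟩
    (E ⊛ ((X ⊕ (P ⊛ Y)) ⊛ U)) ⊕ (((E ⊛ P) ⊛ R) ⊛ (Y ⊛ V))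
      ≈⟨ regroup E X Y U V P R ⟩
    (E ⊛ (X ⊛ U)) ⊕ ((E ⊛ P) ⊛ (Y ⊛ (U ⊕ (R ⊛ V))))
      ≈⟨ ⊕-cong (≐-refl {E ⊛ (X ⊛ U)})
                (⊛-cong merge-EP
                        (⊛-cong (≐-refl {Y}) (≐-sym (invPoch-unfold c′ K (suc a + n))))) ⟩
    correction n (suc a) ⊕ (qpow (durfeeExp K c (suc n) (suc a)) ⊛ (Y ⊛ invPoch c K (suc (suc a + n))))
      ≈⟨ ⊕-cong (≐-refl {correction n (suc a)})
                (⊛-cong (≐-refl {qpow (durfeeExp K c (suc n) (suc a))})
                        (⊛-cong (≐-refl {Y}) (≡⇒≐ (cong (invPoch c K) (sym (ℕₚ.+-suc (suc a) n)))))) ⟩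
    correction n (suc a) ⊕ term (suc n) (suc a)
      ∎
    where
    open ≐-Reasoning
    E X Y U V P R : PS
    E = qpow (durfeeExp K c n (suc a))
    X = invPoch K K a
    Y = invPoch K K (suc a)
    U = invPoch c K (suc a + n)
    V = invPoch c K (suc (suc a + n))
    P = qpow (K + K * a)
    R = qpow (c + K * (suc a + n))
    merge-EP : E ⊛ P ≐ qpow (durfeeExp K c (suc n) (suc a))
    merge-EP = ≐-trans (qpow-⊛-qpow (durfeeExp K c n (suc a)) (K + K * a))
                       (≡⇒≐ (cong qpow (sym (durfeeExp-suc-index K c n a))))
    split-E : (E ⊛ P) ⊛ R ≐ qpow (durfeeExp K c n (suc a) + (K + K * a) + (c + K * (suc a + n)))
    split-E = ≐-trans (⊛-cong (qpow-⊛-qpow (durfeeExp K c n (suc a)) (K + K * a)) (≐-refl {R}))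
                      (qpow-⊛-qpow (durfeeExp K c n (suc a) + (K + K * a)) (c + K * (suc a + n)))
    regroup : ∀ E X Y U V P R → (E ⊛ ((X ⊕ (P ⊛ Y)) ⊛ U)) ⊕ (((E ⊛ P) ⊛ R) ⊛ (Y ⊛ V))
                              ≐ (E ⊛ (X ⊛ U)) ⊕ ((E ⊛ P) ⊛ (Y ⊛ (U ⊕ (R ⊛ V))))
    regroup = solve 7 (λ E X Y U V P R → E :* ((X :+ P :* Y) :* U) :+ ((E :* P) :* R) :* (Y :* V)
                                      := E :* (X :* U) :+ (E :* P) :* (Y :* (U :+ R :* V))) ≐-refl

  partialSum : ℕ → ℕ → PS
  partialSum n = sumS (term n)

  partialSum-suc-index : ∀ n A → partialSum n A ⊕ correction n A ≐ partialSum (suc n) A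
  partialSum-suc-index n zero    = ⊕-identityˡ zeroS
  partialSum-suc-index n (suc A) = begin
    (partialSum n A ⊕ term n A) ⊕ correction n (suc A)      ≈⟨ ⊕-assoc (partialSum n A) _ _ ⟩
    partialSum n A ⊕ (term n A ⊕ correction n (suc A))
      ≈⟨ ⊕-cong (≐-refl {partialSum n A}) (term-telescopes n A) ⟩
    partialSum n A ⊕ (correction n A ⊕ term (suc n) A)      ≈⟨ ≐-sym (⊕-assoc (partialSum n A) _ _) ⟩
    (partialSum n A ⊕ correction n A) ⊕ term (suc n) A      ≈⟨ ⊕-cong (partialSum-suc-index n A) ≐-refl ⟩
    partialSum (suc n) A ⊕ term (suc n) A                   ∎
    where open ≐-Reasoning

  correction≈zero : ∀ {N} n A → N < A → correction n A ≈[ N ] zeroS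
  correction≈zero n (suc a) N<A = qpow-⊛≈zero _ _ (ℕₚ.<-≤-trans N<A (size≤durfeeExp K c′ n a))

  partialSum-shift : ∀ {N} n A → N < A → partialSum n A ≈[ N ] partialSum (suc n) A
  partialSum-shift n A N<A =
    ≈-trans (≐⇒≈ (≐-sym (⊕-identityʳ (partialSum n A))))
    (≈-trans (⊕-cong≈ (≈-refl {partialSum n A}) (≈-sym (correction≈zero n A N<A)))
             (≐⇒≈ (partialSum-suc-index n A)))

  partialSum-shift-by : ∀ {N} n A → N < A → ∀ j → partialSum n A ≈[ N ] partialSum (j + n) A
  partialSum-shift-by n A N<A zero    = ≈-refl
  partialSum-shift-by n A N<A (suc j) =
    ≈-trans (partialSum-shift-by n A N<A j) (partialSum-shift (j + n) A N<A)

  partialSum≈leading : ∀ {N} n → N < n → ∀ A → partialSum n (suc A) ≈[ N ] invPoch c K n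
  partialSum≈leading n N<n zero =
    ≐⇒≈ (≐-trans (⊕-identityˡ (term n 0))
         (≐-trans (⊛-identityˡ (oneS ⊛ invPoch c K n)) (⊛-identityˡ (invPoch c K n))))
  partialSum≈leading n N<n (suc A) =
    ≈-trans (⊕-cong≈ (partialSum≈leading n N<n A)
                     (qpow-⊛≈zero _ _ (ℕₚ.<-≤-trans N<n (index≤durfeeExp K′ c n A))))
            (≐⇒≈ (⊕-identityʳ (invPoch c K n)))

  durfee-identity : ∀ {N} n A → N < A → partialSum n A ≈[ N ] invPoch c K N
  durfee-identity {N} n (suc A) N<A =
    ≈-trans (partialSum-shift-by n (suc A) N<A (suc N))
    (≈-trans (partialSum≈leading (suc N + n) (s≤s (ℕₚ.m≤m+n N n)) A)
             (invPoch-stable c′ K′ (suc N + n) (ℕₚ.≤-trans (ℕₚ.n≤1+n N) (ℕₚ.m≤m+n (suc N) n))))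

listSum : {A : Set} → List A → (A → PS) → PS
listSum xs F = foldr _⊕_ zeroS (map F xs)

listSum-cong : ∀ {A : Set} (xs : List A) {F G} → (∀ x → F x ≐ G x) → listSum xs F ≐ listSum xs G
listSum-cong []       F≐G = ≐-refl
listSum-cong (x ∷ xs) F≐G = ⊕-cong (F≐G x) (listSum-cong xs F≐G)

listSum-cong≈ : ∀ {A : Set} {N} (xs : List A) {F G} →
                (∀ x → F x ≈[ N ] G x) → listSum xs F ≈[ N ] listSum xs G
listSum-cong≈ []       F≈G = ≈-refl
listSum-cong≈ (x ∷ xs) F≈G = ⊕-cong≈ (F≈G x) (listSum-cong≈ xs F≈G)

listSum-zero : ∀ {A : Set} (xs : List A) → listSum xs (λ _ → zeroS) ≐ zeroS
listSum-zero []       = ≐-refl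
listSum-zero (x ∷ xs) = ≐-trans (⊕-cong (≐-refl {zeroS}) (listSum-zero xs)) (⊕-identityˡ zeroS)

listSum-++ : ∀ {A : Set} (xs ys : List A) F → listSum (xs ++ ys) F ≐ listSum xs F ⊕ listSum ys F
listSum-++ []       ys F = ≐-sym (⊕-identityˡ (listSum ys F))
listSum-++ (x ∷ xs) ys F =
  ≐-trans (⊕-cong (≐-refl {F x}) (listSum-++ xs ys F)) (≐-sym (⊕-assoc (F x) (listSum xs F) (listSum ys F)))

listSum-map : ∀ {A B : Set} (h : A → B) (xs : List A) F → listSum (map h xs) F ≐ listSum xs (F ∘ h)
listSum-map h []       F = ≐-refl
listSum-map h (x ∷ xs) F = ⊕-cong (≐-refl {F (h x)}) (listSum-map h xs F)

listSum-concatMap : ∀ {A B : Set} (g : A → List B) (xs : List A) F →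
                    listSum (concatMap g xs) F ≐ listSum xs (λ x → listSum (g x) F)
listSum-concatMap g []       F = ≐-refl
listSum-concatMap g (x ∷ xs) F =
  ≐-trans (listSum-++ (g x) (concatMap g xs) F) (⊕-cong (≐-refl {listSum (g x) F}) (listSum-concatMap g xs F))

listSum-⊕ : ∀ {A : Set} (xs : List A) F G → listSum xs (λ x → F x ⊕ G x) ≐ listSum xs F ⊕ listSum xs G
listSum-⊕ []       F G = ≐-sym (⊕-identityˡ zeroS)
listSum-⊕ (x ∷ xs) F G =
  ≐-trans (⊕-cong (≐-refl {F x ⊕ G x}) (listSum-⊕ xs F G)) (⊕-interchange (F x) (G x) _ _)

listSum-swap : ∀ {A B : Set} (xs : List A) (ys : List B) (G : A → B → PS) →
               listSum xs (λ x → listSum ys (G x)) ≐ listSum ys (λ y → listSum xs (λ x → G x y))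
listSum-swap []       ys G = ≐-sym (listSum-zero ys)
listSum-swap (x ∷ xs) ys G =
  ≐-trans (⊕-cong (≐-refl {listSum ys (G x)}) (listSum-swap xs ys G))
          (≐-sym (listSum-⊕ ys (G x) (λ y → listSum xs (λ x → G x y))))

listSum-⊛ : ∀ {A : Set} (xs : List A) g F → listSum xs (λ x → g ⊛ F x) ≐ g ⊛ listSum xs F
listSum-⊛ []       g F = ≐-sym (⊛-zeroʳ g)
listSum-⊛ (x ∷ xs) g F =
  ≐-trans (⊕-cong (≐-refl {g ⊛ F x}) (listSum-⊛ xs g F)) (≐-sym (⊛-distribˡ g (F x) (listSum xs F)))

listSum-upTo : ∀ n F → listSum (upTo n) F ≐ sumS F n
listSum-upTo zero    F = ≐-refl
listSum-upTo (suc n) F = begin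
  listSum (upTo (suc n)) F          ≡⟨ cong (λ l → listSum l F) (sym (Listₚ.upTo-∷ʳ n)) ⟩
  listSum (upTo n ∷ʳ n) F           ≈⟨ listSum-++ (upTo n) (n ∷ []) F ⟩
  listSum (upTo n) F ⊕ (F n ⊕ zeroS) ≈⟨ ⊕-cong (listSum-upTo n F) (⊕-identityʳ (F n)) ⟩
  sumS F n ⊕ F n                     ∎
  where open ≐-Reasoning

if-cong : ∀ d {f g} → f ≐ g → (if d then f else zeroS) ≐ (if d then g else zeroS)
if-cong true  f≐g = f≐g
if-cong false f≐g = ≐-refl

if-∧ : ∀ b d (f : PS) → (if b ∧ d then f else zeroS) ≡ (if d then (if b then f else zeroS) else zeroS)
if-∧ true  d     f = refl
if-∧ false true  f = refl
if-∧ false false f = refl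

⊛-if : ∀ d g f → g ⊛ (if d then f else zeroS) ≐ (if d then g ⊛ f else zeroS)
⊛-if true  g f = ≐-refl
⊛-if false g f = ⊛-zeroʳ g

listSum-if : ∀ {A : Set} (xs : List A) d F →
             listSum xs (λ x → if d then F x else zeroS) ≐ (if d then listSum xs F else zeroS)
listSum-if xs true  F = ≐-refl
listSum-if xs false F = listSum-zero xs

decreasing-∷ : ∀ {L} x (m : Vec ℕ L) → decreasing (x ∷ m) ≡ (hd m ≤ᵇ x) ∧ decreasing m
decreasing-∷ x []      = refl
decreasing-∷ x (y ∷ m) = refl

truncSum-suc : ∀ L B (t : Vec ℕ (suc L) → PS) →
  truncSum (suc L) B t
  ≐ listSum (allVecs L B)
      (λ m → if decreasing m then sumS (λ x → if hd m ≤ᵇ x then t (x ∷ m) else zeroS) (suc B) else zeroS)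
truncSum-suc L B t = begin
  listSum (concatMap (λ x → map (x ∷_) (allVecs L B)) (upTo (suc B))) F
    ≈⟨ listSum-concatMap (λ x → map (x ∷_) (allVecs L B)) (upTo (suc B)) F ⟩
  listSum (upTo (suc B)) (λ x → listSum (map (x ∷_) (allVecs L B)) F)
    ≈⟨ listSum-cong (upTo (suc B)) (λ x → listSum-map (x ∷_) (allVecs L B) F) ⟩
  listSum (upTo (suc B)) (λ x → listSum (allVecs L B) (λ m → F (x ∷ m)))
    ≈⟨ listSum-swap (upTo (suc B)) (allVecs L B) (λ x m → F (x ∷ m)) ⟩
  listSum (allVecs L B) (λ m → listSum (upTo (suc B)) (λ x → F (x ∷ m)))
    ≈⟨ listSum-cong (allVecs L B) inner ⟩
  listSum (allVecs L B) (λ m → if decreasing m then sumS (H m) (suc B) else zeroS)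
    ∎
  where
  open ≐-Reasoning
  F : Vec ℕ (suc L) → PS
  F m = if decreasing m then t m else zeroS
  H : Vec ℕ L → ℕ → PS
  H m x = if hd m ≤ᵇ x then t (x ∷ m) else zeroS
  inner : ∀ m → listSum (upTo (suc B)) (λ x → F (x ∷ m))
              ≐ (if decreasing m then sumS (H m) (suc B) else zeroS)
  inner m = begin
    listSum (upTo (suc B)) (λ x → F (x ∷ m))
      ≈⟨ listSum-cong (upTo (suc B)) (λ x → ≡⇒≐
           (trans (cong (λ b → if b then t (x ∷ m) else zeroS) (decreasing-∷ x m))
                  (if-∧ (hd m ≤ᵇ x) (decreasing m) (t (x ∷ m))))) ⟩
    listSum (upTo (suc B)) (λ x → if decreasing m then H m x else zeroS)
      ≈⟨ listSum-if (upTo (suc B)) (decreasing m) (H m) ⟩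
    (if decreasing m then listSum (upTo (suc B)) (H m) else zeroS)
      ≈⟨ if-cong (decreasing m) (listSum-upTo (suc B) (H m)) ⟩
    (if decreasing m then sumS (H m) (suc B) else zeroS)
      ∎

module Peel (K′ c′ : ℕ) where
  open Durfee K′ c′

  module _ {N L B} (2N≤B : N + N ≤ B) (t₁ : Vec ℕ (suc L) → PS) (t₀ : Vec ℕ L → PS) (m : Vec ℕ L)
           (factor : ∀ a → t₁ ((a + hd m) ∷ m) ≐ term (hd m) a ⊛ t₀ m)
           (decay : N < hd m → t₀ m ≈[ N ] zeroS) where

    private
      y : ℕ
      y = hd m
      H : ℕ → PS
      H x = if y ≤ᵇ x then t₁ (x ∷ m) else zeroS

    -- Since N + N ≤ B, either m_1 ranges over more than N values of a = m_1 - m_2,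
    -- or m_2 > N and everything vanishes modulo q^(N+1).
    sum-over-head : sumS H (suc B) ≈[ N ] invPoch c K N ⊛ t₀ m
    sum-over-head with y ℕ.≤? N
    ... | yes y≤N = ≈-trans (≐⇒≈ reindexed) (⊛-cong≈ (durfee-identity y (suc (B ∸ y)) N<range) ≈-refl)
      where
      y≤B : y ≤ B
      y≤B = ℕₚ.≤-trans y≤N (ℕₚ.≤-trans (ℕₚ.m≤m+n N N) 2N≤B)
      N<range : N < suc (B ∸ y)
      N<range = s≤s (ℕₚ.m+n≤o⇒m≤o∸n N (ℕₚ.≤-trans (ℕₚ.+-monoʳ-≤ N y≤N) 2N≤B))
      reindexed : sumS H (suc B) ≐ partialSum y (suc (B ∸ y)) ⊛ t₀ m
      reindexed = begin
        sumS H (suc B)                                ≡⟨ cong (sumS H ∘ suc) (sym (ℕₚ.m∸n+n≡m y≤B)) ⟩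
        sumS H (suc (B ∸ y) + y)                      ≈⟨ sumS-from y (λ x → t₁ (x ∷ m)) (suc (B ∸ y)) ⟩
        sumS (λ a → t₁ ((a + y) ∷ m)) (suc (B ∸ y))    ≈⟨ sumS-cong (suc (B ∸ y)) factor ⟩
        sumS (λ a → term y a ⊛ t₀ m) (suc (B ∸ y))     ≈⟨ sumS-⊛ (term y) (t₀ m) (suc (B ∸ y)) ⟩
        partialSum y (suc (B ∸ y)) ⊛ t₀ m             ∎
        where open ≐-Reasoning
    ... | no y≰N = ≈-trans (sumS≈zero H (suc B) (λ x _ → H≈zero x))
                           (≈-sym (⊛-cong≈zero (invPoch c K N) (decay N<y)))
      where
      N<y : N < y
      N<y = ℕₚ.≰⇒> y≰N
      H≈zero : ∀ x → H x ≈[ N ] zeroS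
      H≈zero x with y ≤ᵇ x in y≤ᵇx
      ... | false = ≈-refl
      ... | true  = ≈-trans (≐⇒≈ (≐-trans (≡⇒≐ (cong (λ z → t₁ (z ∷ m)) x≡a+y)) (factor a)))
                            (⊛-cong≈zero (term y a) (decay N<y))
        where
        a = x ∸ y
        x≡a+y : x ≡ a + y
        x≡a+y = sym (ℕₚ.m∸n+n≡m (ℕₚ.≤ᵇ⇒≤ y x (Equivalence.from T-≡ y≤ᵇx)))

  truncSum-peel : ∀ {N} L B → N + N ≤ B → (t₁ : Vec ℕ (suc L) → PS) (t₀ : Vec ℕ L → PS) →
    (∀ a m → decreasing m ≡ true → t₁ ((a + hd m) ∷ m) ≐ term (hd m) a ⊛ t₀ m) →
    (∀ m → decreasing m ≡ true → N < hd m → t₀ m ≈[ N ] zeroS) →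
    truncSum (suc L) B t₁ ≈[ N ] invPoch c K N ⊛ truncSum L B t₀
  truncSum-peel {N} L B 2N≤B t₁ t₀ factor decay =
    ≈-trans (≐⇒≈ (truncSum-suc L B t₁))
    (≈-trans (listSum-cong≈ (allVecs L B) summand)
             (≐⇒≈ (≐-trans (listSum-cong (allVecs L B) (λ m → ≐-sym (⊛-if (decreasing m) I (t₀ m))))
                           (listSum-⊛ (allVecs L B) I (λ m → if decreasing m then t₀ m else zeroS)))))
    where
    I : PS
    I = invPoch c K N
    summand : ∀ m → (if decreasing m then sumS (λ x → if hd m ≤ᵇ x then t₁ (x ∷ m) else zeroS) (suc B)
                                      else zeroS)
                    ≈[ N ] (if decreasing m then I ⊛ t₀ m else zeroS)
    summand m with decreasing m in dm
    ... | true  = sum-over-head 2N≤B t₁ t₀ m (λ a → factor a m dm) (decay m dm)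
    ... | false = ≈-refl

quadExp-∷ : ∀ {L} x (m : Vec ℕ L) → quadExp (x ∷ m) ≡ x * (x ∸ hd m) + quadExp m
quadExp-∷ x []      = refl
quadExp-∷ x (y ∷ m) = refl

diffs-∷ : ∀ {L} x (m : Vec ℕ L) → diffs (x ∷ m) ≡ (x ∸ hd m) ∷ diffs m
diffs-∷ x []      = refl
diffs-∷ x (y ∷ m) = refl

hd≤quadExp : ∀ {L} (m : Vec ℕ L) → decreasing m ≡ true → hd m ≤ quadExp m
hd≤quadExp []          _ = z≤n
hd≤quadExp (x ∷ [])    _ = ℕₚ.≤-trans (m≤m*m x) (ℕₚ.m≤m+n (x * x) 0)
  where
  m≤m*m : ∀ x → x ≤ x * x
  m≤m*m zero    = z≤n
  m≤m*m (suc x) = ℕₚ.m≤m*n (suc x) (suc x)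
hd≤quadExp (x ∷ y ∷ m) d = begin
  x                                    ≡⟨ sym (ℕₚ.m∸n+n≡m y≤x) ⟩
  (x ∸ y) + y
    ≤⟨ ℕₚ.+-mono-≤ (gap≤ x (ℕₚ.m∸n≤m x y)) (hd≤quadExp (y ∷ m) tail) ⟩
  x * (x ∸ y) + quadExp (y ∷ m)        ∎
  where
  open ℕₚ.≤-Reasoning
  split : ∀ {a b} → a ∧ b ≡ true → T a × b ≡ true
  split {true} {true} _ = _ , refl
  y≤x : y ≤ x
  y≤x = ℕₚ.≤ᵇ⇒≤ y x (proj₁ (split d))
  tail : decreasing (y ∷ m) ≡ true
  tail = proj₂ (split {y ≤ᵇ x} d)
  gap≤ : ∀ x {d} → d ≤ x → d ≤ x * d
  gap≤ zero    z≤n = z≤n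
  gap≤ (suc x) _   = ℕₚ.m≤n*m _ (suc x)

module FirstIdentity where
  open Durfee 0 0
  open Peel 0 0

  term-exponent : ∀ y a → durfeeExp 1 1 y a ≡ (a + y) * a
  term-exponent y zero    = sym (ℕₚ.*-zeroʳ y)
  term-exponent y (suc a) = unfolded a y
    where
    unfolded : ∀ a y → 1 * (suc a * (a + y)) + 1 * suc a ≡ (suc a + y) * suc a
    unfolded = solve-∀

  term1-factor : ∀ {L} a (m : Vec ℕ L) → term1 ((a + hd m) ∷ m) ≐ term (hd m) a ⊛ term1 m
  term1-factor a m = begin
    term1 (x ∷ m)
      ≈⟨ ⊛-cong (≡⇒≐ (cong qpow (quadExp-∷ x m)))
                (⊛-cong (≐-refl {prodS (Vec.map I (x ∷ m))})
                        (≡⇒≐ (cong (prodS ∘ Vec.map I) (diffs-∷ x m)))) ⟩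
    qpow (x * (x ∸ y) + quadExp m) ⊛ ((I x ⊛ P) ⊛ (I (x ∸ y) ⊛ D))
      ≈⟨ ⊛-cong (≐-sym (qpow-⊛-qpow (x * (x ∸ y)) (quadExp m)))
                (⊛-cong (≐-refl {I x ⊛ P}) (⊛-cong (≡⇒≐ (cong I x∸y≡a)) ≐-refl)) ⟩
    (qpow (x * (x ∸ y)) ⊛ qpow (quadExp m)) ⊛ ((I x ⊛ P) ⊛ (I a ⊛ D))
      ≈⟨ regroup (qpow (x * (x ∸ y))) (qpow (quadExp m)) (I a) (I x) P D ⟩
    (qpow (x * (x ∸ y)) ⊛ (I a ⊛ I x)) ⊛ (qpow (quadExp m) ⊛ (P ⊛ D))
      ≈⟨ ⊛-cong (⊛-cong (≡⇒≐ (cong qpow (trans (cong (x *_) x∸y≡a) (sym (term-exponent y a)))))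
                        ≐-refl)
                ≐-refl ⟩
    term y a ⊛ term1 m
      ∎
    where
    open ≐-Reasoning
    y = hd m
    x = a + y
    I : ℕ → PS
    I = invPoch 1 1
    P D : PS
    P = prodS (Vec.map I m)
    D = prodS (Vec.map I (diffs m))
    x∸y≡a : x ∸ y ≡ a
    x∸y≡a = ℕₚ.m+n∸n≡m a y
    regroup : ∀ E₁ E₂ Ia Ix P D →
              (E₁ ⊛ E₂) ⊛ ((Ix ⊛ P) ⊛ (Ia ⊛ D)) ≐ (E₁ ⊛ (Ia ⊛ Ix)) ⊛ (E₂ ⊛ (P ⊛ D))
    regroup = solve 6 (λ E₁ E₂ Ia Ix P D → (E₁ :* E₂) :* ((Ix :* P) :* (Ia :* D))
                                        := (E₁ :* (Ia :* Ix)) :* (E₂ :* (P :* D))) ≐-refl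

  term1-decay : ∀ {N L} (m : Vec ℕ L) → decreasing m ≡ true → N < hd m → term1 m ≈[ N ] zeroS
  term1-decay m d N<y = qpow-⊛≈zero (quadExp m) _ (ℕₚ.<-≤-trans N<y (hd≤quadExp m d))

  truncSum-term1 : ∀ {N} L B → N + N ≤ B → truncSum L B term1 ≈[ N ] invPoch 1 1 N ^S L
  truncSum-term1 zero B _ =
    ≐⇒≈ (≐-trans (⊕-identityʳ (term1 [])) (≐-trans (⊛-identityˡ (oneS ⊛ oneS)) (⊛-identityˡ oneS)))
  truncSum-term1 {N} (suc L) B 2N≤B =
    ≈-trans (truncSum-peel L B 2N≤B term1 term1 (λ a m _ → term1-factor a m) term1-decay)
            (⊛-cong≈ (≈-refl {invPoch 1 1 N}) (truncSum-term1 L B 2N≤B))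

invPochProduct : (k c l M : ℕ) → PS
invPochProduct k c zero    M = oneS
invPochProduct k c (suc l) M = invPoch c k M ⊛ invPochProduct k (suc c) l M

invPochProduct-zero : ∀ k c l → invPochProduct k c l 0 ≐ oneS
invPochProduct-zero k c zero    = ≐-refl
invPochProduct-zero k c (suc l) =
  ≐-trans (⊛-identityˡ (invPochProduct k (suc c) l 0)) (invPochProduct-zero k (suc c) l)

invPochProduct-suc : ∀ k c l M →
  invPochProduct k c l (suc M) ≐ invPochProduct k c l M ⊛ invPoch (c + k * M) 1 l
invPochProduct-suc k c zero    M = ≐-sym (⊛-identityʳ oneS)
invPochProduct-suc k c (suc l) M = begin
  (invPoch c k M ⊛ geoInv (c + k * M)) ⊛ invPochProduct k (suc c) l (suc M)
    ≈⟨ ⊛-cong (≐-refl {invPoch c k (suc M)}) (invPochProduct-suc k (suc c) l M) ⟩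
  (invPoch c k M ⊛ geoInv (c + k * M)) ⊛ (invPochProduct k (suc c) l M ⊛ invPoch (suc c + k * M) 1 l)
    ≈⟨ regroup (invPoch c k M) (geoInv (c + k * M)) (invPochProduct k (suc c) l M) _ ⟩
  invPochProduct k c (suc l) M ⊛ (geoInv (c + k * M) ⊛ invPoch (suc c + k * M) 1 l)
    ≈⟨ ⊛-cong (≐-refl {invPochProduct k c (suc l) M})
              (≐-sym (≐-trans (invPoch-first (c + k * M) 1 l)
                              (⊛-cong (≐-refl {geoInv (c + k * M)})
                                      (≡⇒≐ (cong (λ a → invPoch a 1 l) (ℕₚ.+-comm (c + k * M) 1)))))) ⟩
  invPochProduct k c (suc l) M ⊛ invPoch (c + k * M) 1 (suc l)
    ∎
  where
  open ≐-Reasoning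
  regroup : ∀ I g P J → (I ⊛ g) ⊛ (P ⊛ J) ≐ (I ⊛ P) ⊛ (g ⊛ J)
  regroup = solve 4 (λ I g P J → (I :* g) :* (P :* J) := (I :* P) :* (g :* J)) ≐-refl

invPochProduct-residues : ∀ k M → invPochProduct k 1 k M ≐ invPoch 1 1 (k * M)
invPochProduct-residues k zero =
  ≐-trans (invPochProduct-zero k 1 k) (≡⇒≐ (cong (invPoch 1 1) (sym (ℕₚ.*-zeroʳ k))))
invPochProduct-residues k (suc M) = begin
  invPochProduct k 1 k (suc M)
    ≈⟨ invPochProduct-suc k 1 k M ⟩
  invPochProduct k 1 k M ⊛ invPoch (1 + k * M) 1 k
    ≈⟨ ⊛-cong (invPochProduct-residues k M)
              (≡⇒≐ (cong (λ a → invPoch (suc a) 1 k) (sym (ℕₚ.*-identityˡ (k * M))))) ⟩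
  invPoch 1 1 (k * M) ⊛ invPoch (1 + 1 * (k * M)) 1 k
    ≈⟨ ≐-sym (invPoch-split 1 1 (k * M) k) ⟩
  invPoch 1 1 (k * M + k)
    ≡⟨ cong (invPoch 1 1) (trans (ℕₚ.+-comm (k * M) k) (sym (ℕₚ.*-suc k M))) ⟩
  invPoch 1 1 (k * suc M)
    ∎
  where open ≐-Reasoning

durfeeExp-tail : ∀ c l y a →
  suc (c + l) * ((a + y) * a) + (a + y) + l * y ≡ suc l * (a + y) + durfeeExp (suc (c + l)) (suc c) y a
durfeeExp-tail c l y zero    = unfolded c l y
  where
  unfolded : ∀ c l y → suc (c + l) * ((0 + y) * 0) + (0 + y) + l * y ≡ suc l * (0 + y) + 0
  unfolded = solve-∀
durfeeExp-tail c l y (suc a) = unfolded c l y a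
  where
  unfolded : ∀ c l y a → suc (c + l) * ((suc a + y) * suc a) + (suc a + y) + l * y
                       ≡ suc l * (suc a + y) + (suc (c + l) * (suc a * (a + y)) + suc c * suc a)
  unfolded = solve-∀

tailExponent-split : ∀ {k′} c l a y Q S → c + l ≡ k′ → l * y ≤ suc k′ * Q + S →
  (suc k′ * ((a + y) * a + Q) + ((a + y) + S)) ∸ suc l * (a + y)
  ≡ durfeeExp (suc k′) (suc c) y a + ((suc k′ * Q + S) ∸ l * y)
tailExponent-split c l a y Q S refl ly≤ = begin
  (k * ((a + y) * a + Q) + ((a + y) + S)) ∸ suc l * (a + y)  ≡⟨ cong (_∸ suc l * (a + y)) regroup ⟩
  (suc l * (a + y) + (e + R)) ∸ suc l * (a + y)              ≡⟨ ℕₚ.m+n∸m≡n (suc l * (a + y)) (e + R) ⟩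
  e + R                                                    ∎
  where
  open ≡-Reasoning
  k e R : ℕ
  k = suc (c + l)
  e = durfeeExp k (suc c) y a
  R = (k * Q + S) ∸ l * y
  distribute : ∀ k a y Q S → k * ((a + y) * a + Q) + ((a + y) + S) ≡ k * ((a + y) * a) + (a + y) + (k * Q + S)
  distribute = solve-∀
  regroup : k * ((a + y) * a + Q) + ((a + y) + S) ≡ suc l * (a + y) + (e + R)
  regroup = begin
    k * ((a + y) * a + Q) + ((a + y) + S)  ≡⟨ distribute k a y Q S ⟩
    k * ((a + y) * a) + (a + y) + (k * Q + S)
      ≡⟨ cong (k * ((a + y) * a) + (a + y) +_) (sym (ℕₚ.m+[n∸m]≡n ly≤)) ⟩
    k * ((a + y) * a) + (a + y) + (l * y + R)  ≡⟨ sym (ℕₚ.+-assoc (k * ((a + y) * a) + (a + y)) (l * y) R) ⟩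
    k * ((a + y) * a) + (a + y) + l * y + R    ≡⟨ cong (_+ R) (durfeeExp-tail c l y a) ⟩
    suc l * (a + y) + e + R                    ≡⟨ ℕₚ.+-assoc (suc l * (a + y)) e R ⟩
    suc l * (a + y) + (e + R)                  ∎

module SecondIdentity (k′ : ℕ) where

  k : ℕ
  k = suc k′

  -- The summand of the second identity for the last l coordinates (m_c, …, m_k);
  -- term2 is tailTerm2 1 with l = k.
  tailTerm2 : ℕ → ∀ {l} → Vec ℕ l → PS
  tailTerm2 c {l} m = qpow ((k * quadExp m + sumV m) ∸ l * hd m)
                    ⊛ (prodS (Vec.map (invPoch k k) (diffs m)) ⊛ prodIdx k c m)

  tailTerm2-factor : ∀ c {l} → c + l ≡ k′ → ∀ a (m : Vec ℕ l) → decreasing m ≡ true →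
    tailTerm2 (suc c) ((a + hd m) ∷ m) ≐ Durfee.term k′ c (hd m) a ⊛ tailTerm2 (suc (suc c)) m
  tailTerm2-factor c {l} c+l≡k′ a m d = begin
    tailTerm2 (suc c) (x ∷ m)
      ≈⟨ ⊛-cong (≡⇒≐ (cong qpow exponent))
                (⊛-cong (≡⇒≐ (cong (prodS ∘ Vec.map I) diffs-x∷m)) ≐-refl) ⟩
    qpow (e + R) ⊛ ((I a ⊛ D) ⊛ (invPoch (suc c) k x ⊛ P))
      ≈⟨ ⊛-cong (≐-sym (qpow-⊛-qpow e R)) ≐-refl ⟩
    (qpow e ⊛ qpow R) ⊛ ((I a ⊛ D) ⊛ (invPoch (suc c) k x ⊛ P))
      ≈⟨ regroup (qpow e) (qpow R) (I a) (invPoch (suc c) k x) P D ⟩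
    Durfee.term k′ c y a ⊛ tailTerm2 (suc (suc c)) m
      ∎
    where
    open ≐-Reasoning
    y = hd m
    x = a + y
    I : ℕ → PS
    I = invPoch k k
    e R : ℕ
    e = durfeeExp k (suc c) y a
    R = (k * quadExp m + sumV m) ∸ l * y
    P D : PS
    P = prodIdx k (suc (suc c)) m
    D = prodS (Vec.map I (diffs m))
    x∸y≡a : x ∸ y ≡ a
    x∸y≡a = ℕₚ.m+n∸n≡m a y
    diffs-x∷m : diffs (x ∷ m) ≡ a ∷ diffs m
    diffs-x∷m = trans (diffs-∷ x m) (cong (_∷ diffs m) x∸y≡a)
    ly≤ : l * y ≤ k * quadExp m + sumV m
    ly≤ = ℕₚ.≤-trans (ℕₚ.*-mono-≤ l≤k (hd≤quadExp m d)) (ℕₚ.m≤m+n (k * quadExp m) (sumV m))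
      where
      l≤k : l ≤ k
      l≤k = ℕₚ.≤-trans (ℕₚ.m≤n+m l (suc c)) (ℕₚ.≤-reflexive (cong suc c+l≡k′))
    exponent : (k * quadExp (x ∷ m) + sumV (x ∷ m)) ∸ suc l * x ≡ e + R
    exponent = trans (cong (λ q → (k * q + (x + sumV m)) ∸ suc l * x)
                           (trans (quadExp-∷ x m) (cong (λ d → x * d + quadExp m) x∸y≡a)))
                     (tailExponent-split c l a y (quadExp m) (sumV m) c+l≡k′ ly≤)
    regroup : ∀ E₁ E₂ Ia Ix P D →
              (E₁ ⊛ E₂) ⊛ ((Ia ⊛ D) ⊛ (Ix ⊛ P)) ≐ (E₁ ⊛ (Ia ⊛ Ix)) ⊛ (E₂ ⊛ (D ⊛ P))
    regroup = solve 6 (λ E₁ E₂ Ia Ix P D → (E₁ :* E₂) :* ((Ia :* D) :* (Ix :* P))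
                                        := (E₁ :* (Ia :* Ix)) :* (E₂ :* (D :* P))) ≐-refl

  tailTerm2-decay : ∀ {N} c {l} → c + l ≡ k′ → (m : Vec ℕ l) → decreasing m ≡ true →
                    N < hd m → tailTerm2 (suc (suc c)) m ≈[ N ] zeroS
  tailTerm2-decay c {l} c+l≡k′ m d N<y =
    qpow-⊛≈zero _ _ (ℕₚ.<-≤-trans N<y (ℕₚ.m+n≤o⇒m≤o∸n (hd m) [1+l]y≤))
    where
    1+l≤k : suc l ≤ k
    1+l≤k = s≤s (ℕₚ.≤-trans (ℕₚ.m≤n+m l c) (ℕₚ.≤-reflexive c+l≡k′))
    [1+l]y≤ : suc l * hd m ≤ k * quadExp m + sumV m
    [1+l]y≤ = ℕₚ.≤-trans (ℕₚ.*-mono-≤ 1+l≤k (hd≤quadExp m d)) (ℕₚ.m≤m+n (k * quadExp m) (sumV m))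

  truncSum-tailTerm2 : ∀ {N} B → N + N ≤ B → ∀ L c → c + L ≡ k →
                       truncSum L B (tailTerm2 (suc c)) ≈[ N ] invPochProduct k (suc c) L N
  truncSum-tailTerm2 B 2N≤B zero c _ =
    ≐⇒≈ (≐-trans (⊕-identityʳ (tailTerm2 (suc c) []))
        (≐-trans (⊛-cong (≡⇒≐ (cong (λ e → qpow ((e + 0) ∸ 0)) (ℕₚ.*-zeroʳ k))) ≐-refl)
        (≐-trans (⊛-identityˡ (oneS ⊛ oneS)) (⊛-identityˡ oneS))))
  truncSum-tailTerm2 {N} B 2N≤B (suc l) c c+L≡k =
    ≈-trans (Peel.truncSum-peel k′ c l B 2N≤B (tailTerm2 (suc c)) (tailTerm2 (suc (suc c)))
               (tailTerm2-factor c c+l≡k′) (tailTerm2-decay c c+l≡k′))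
            (⊛-cong≈ (≈-refl {invPoch (suc c) k N}) (truncSum-tailTerm2 B 2N≤B l (suc c) 1+c+l≡k))
    where
    1+c+l≡k : suc c + l ≡ k
    1+c+l≡k = trans (sym (ℕₚ.+-suc c l)) c+L≡k
    c+l≡k′ : c + l ≡ k′
    c+l≡k′ = ℕₚ.suc-injective 1+c+l≡k

eqLim-intro : ∀ {S T : ℕ → PS} → (∀ {N} B → N + N ≤ B → S B ≈[ N ] T B) → EqLim S T
eqLim-intro S≈T N = N + N , λ B 2N≤B → S≈T B 2N≤B N ℕₚ.≤-refl

corollary2 : (k : ℕ) → 1 ≤ k →
    EqLim (λ B → truncSum k B term1) (λ B → invPoch 1 1 B ^S k)
    × EqLim (λ B → truncSum k B term2) (λ B → invPoch 1 1 B)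
corollary2 zero    ()
corollary2 (suc k′) _ = eqLim-intro first , eqLim-intro second
  where
  k : ℕ
  k = suc k′
  N≤B : ∀ {N B} → N + N ≤ B → N ≤ B
  N≤B {N} = ℕₚ.≤-trans (ℕₚ.m≤m+n N N)
  first : ∀ {N} B → N + N ≤ B → truncSum k B term1 ≈[ N ] invPoch 1 1 B ^S k
  first B 2N≤B = ≈-trans (FirstIdentity.truncSum-term1 k B 2N≤B)
                         (≈-sym (^S-cong≈ k (invPoch-stable 0 0 B (N≤B 2N≤B))))
  second : ∀ {N} B → N + N ≤ B → truncSum k B term2 ≈[ N ] invPoch 1 1 B
  second {N} B 2N≤B =
    ≈-trans (SecondIdentity.truncSum-tailTerm2 k′ B 2N≤B k 0 refl)
    (≈-trans (≐⇒≈ (invPochProduct-residues k N))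
    (≈-trans (invPoch-stable 0 0 (k * N) (ℕₚ.m≤n*m N k))
             (≈-sym (invPoch-stable 0 0 B (N≤B 2N≤B)))))
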